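{- Let $f \colon \mathbb{N} \setminus \{0\} \to \mathbb{N} \setminus \{0\}$ be a function which has a finite-fold Diophantine representation. Then there exists a positive integer $m$ such that $f(n)<\theta(n)$ for every integer $n>m$.
   Context: $\mathbb{N}$ denotes the set of non-negative integers. A set $\mathcal{M} \subseteq \mathbb{N}^k$ has a finite-fold Diophantine representation if there is a polynomial $W(a_1,\ldots,a_k,x_1,\ldots,x_r)$ with integer coefficients such that for all $(a_1,\ldots,a_k)\in\mathbb{N}^k$: $(a_1,\ldots,a_k)\in\mathcal{M}$ iff there exist $x_1,\ldots,x_r \in \mathbb{N}$ with $W(a_1,\ldots,a_k,x_1,\ldots,x_r)=0$, and moreover for every $(a_1,\ldots,a_k)\in\mathbb{N}^k$ the equation $W(a_1,\ldots,a_k,x_1,\ldots,x_r)=0$ has only finitely many solutions $(x_1,\ldots,x_r)\in\mathbb{N}^r$. A function $f$ is said to have a finite-fold Diophantine representation if its graph $\{(n,f(n))\} \subseteq \mathbb{N}^2$ does. For a positive integer $n$, let $E_n=\{x_i \cdot x_j=x_k,\ x_i+1=x_k:\ i,j,k \in \{1,\ldots,n\}\}$, and let $\theta(n)$ denote the smallest positive integer $b$ such that for each system $S \subseteq E_n$ which has a solution in positive integers $x_1,\ldots,x_n$ and which has only finitely many solutions in positive integers $x_1,\ldots,x_n$, there exists a solution of $S$ in $([1,b] \cap \mathbb{N})^n$. -}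

module Defs where

open import Data.Nat using (ℕ; zero; suc; _+_; _≤_; _<_)
open import Data.Integer as ℤ using (ℤ; +_)
open import Data.Fin using (Fin)
open import Data.Vec using (Vec; []; _∷_; lookup; _++_; map)
open import Data.Vec.Relation.Unary.All using (All)
open import Data.List using (List)
open import Data.List.Relation.Unary.All as LAll using ()
open import Data.List.Membership.Propositional using (_∈_)
open import Data.Product using (Σ; ∃; _×_)
open import Relation.Binary.PropositionalEquality using (_≡_)

data Poly (v : ℕ) : Set where
  var : Fin v → Poly v
  con : ℤ → Poly v
  _⊕_ : Poly v → Poly v → Poly v
  _⊗_ : Poly v → Poly v → Poly v

eval : ∀ {v} → Poly v → Vec ℤ v → ℤ
eval (var i) ρ = lookup ρ i
eval (con c) ρ = c
eval (p ⊕ q) ρ = eval p ρ ℤ.+ eval q ρ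
eval (p ⊗ q) ρ = eval p ρ ℤ.* eval q ρ

Zero : ∀ {k r} → Poly (k + r) → Vec ℕ k → Vec ℕ r → Set
Zero W a x = eval W (map +_ (a ++ x)) ≡ + 0

-- A set M ⊆ ℕ^k has a finite-fold Diophantine representation.
-- "Finitely many solutions" = all solutions occur in some finite list.
FiniteFoldDiophantine : (k : ℕ) → (Vec ℕ k → Set) → Set
FiniteFoldDiophantine k M =
  Σ ℕ λ r → Σ (Poly (k + r)) λ W →
    ((a : Vec ℕ k) → (M a → ∃ λ (x : Vec ℕ r) → Zero W a x)
                   × ((∃ λ (x : Vec ℕ r) → Zero W a x) → M a))
    × ((a : Vec ℕ k) → ∃ λ (L : List (Vec ℕ r)) →
         (x : Vec ℕ r) → Zero W a x → x ∈ L)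

-- Graph of f : ℕ∖{0} → ℕ∖{0} (f given on ℕ, only values at n ≥ 1 matter)
Graph : (ℕ → ℕ) → Vec ℕ 2 → Set
Graph f (n ∷ y ∷ []) = (1 ≤ n) × (y ≡ f n)

data Eqn (n : ℕ) : Set where
  mulEq : Fin n → Fin n → Fin n → Eqn n
  sucEq : Fin n → Fin n → Eqn n

Holds : ∀ {n} → Vec ℕ n → Eqn n → Set
Holds x (mulEq i j k) = lookup x i Data.Nat.* lookup x j ≡ lookup x k
Holds x (sucEq i k) = lookup x i + 1 ≡ lookup x k

System : ℕ → Set
System n = List (Eqn n)

Sol : ∀ {n} → System n → Vec ℕ n → Set
Sol S x = All (λ xi → 1 ≤ xi) x × LAll.All (Holds x) S

FinitelyManySols : ∀ {n} → System n → Set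
FinitelyManySols {n} S =
  ∃ λ (L : List (Vec ℕ n)) → (x : Vec ℕ n) → Sol S x → x ∈ L

ThetaProp : ℕ → ℕ → Set
ThetaProp n b =
  (S : System n) → (∃ λ x → Sol S x) → FinitelyManySols S →
  ∃ λ x → Sol S x × All (λ xi → xi ≤ b) x

IsTheta : ℕ → ℕ → Set
IsTheta n b = (1 ≤ b) × ThetaProp n b × ((b' : ℕ) → 1 ≤ b' → ThetaProp n b' → b ≤ b')

-- For large n the equation W(n, y, x) = 0 representing the graph of f can be simulated by a
-- system S ⊆ E_n. The first variable is forced to be 1 by x₀·x₀ = x₀, the unknowns are stored as
-- y + 1 and x + 1, and O(log n) further equations compute n + 1 by binary doubling and then two
-- expressions W⁺, W⁻ with W = W⁺ − W⁻, whose equality is imposed. Addition z = u + v is expressed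
-- through (z u + 1)(z v + 1) = z²(u v + 1) + 1. Every variable of S is determined by y and x, so the
-- solutions of S correspond to the finitely many solutions of W(n, y, x) = 0, all of which have
-- y = f(n). By the definition of θ(n) one of them lies in [1, θ(n)]ⁿ, hence f(n) + 1 ≤ θ(n).

module Submission where

open import Defs
open import Data.Fin using (Fin; zero; suc; toℕ)
open import Data.Fin.Properties using (toℕ<n)
open import Data.Integer as ℤ using (ℤ; +_; -[1+_])
import Data.Integer.Properties as ℤₚ
open import Algebra.Properties.AbelianGroup ℤₚ.+-0-abelianGroup using (identityˡ-unique)
open import Data.Integer.Tactic.RingSolver as ℤ-Solver using ()
open import Data.List as List using (List; []; _∷_; _++_)
open import Data.List.Membership.Propositional using (_∈_)
open import Data.List.Membership.Propositional.Properties using (∈-map⁺)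
open import Data.List.Relation.Unary.All as All using (All; []; _∷_)
import Data.List.Relation.Unary.All.Properties as All
open import Data.Nat using (ℕ; zero; suc; _+_; _*_; _∸_; _^_; _≤_; _<_; z≤n; s≤s; pred; _<?_; >-nonZero)
open import Data.Nat.Binary as ℕᵇ using (ℕᵇ; 2[1+_]; 1+[2_])
open import Data.Nat.Binary.Properties using (toℕ-fromℕ)
open import Data.Nat.Properties
open import Data.Nat.Tactic.RingSolver using (solve-∀)
open import Data.Product as Product using (Σ; ∃; _×_; _,_; proj₁; proj₂)
open import Data.Unit using (⊤; tt)
open import Data.Vec as Vec using (Vec; []; _∷_; lookup; tabulate)
open import Data.Vec.Properties using (lookup-map; lookup∘tabulate; tabulate∘lookup; tabulate-cong)
import Data.Vec.Relation.Unary.All as VecAll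
import Data.Vec.Relation.Unary.All.Properties as VecAll
open import Function using (_∘_; _⇔_; mk⇔; Equivalence)
open import Relation.Binary.PropositionalEquality
open import Relation.Nullary.Decidable using (True; toWitness)

variable
  b c i j k w : ℕ

-- Equations and valuations

Valuation : Set
Valuation = ℕ → ℕ

variable
  ρ σ τ v : Valuation

data Equation : Set where
  mul : ℕ → ℕ → ℕ → Equation
  inc : ℕ → ℕ → Equation

variable
  e : Equation
  es : List Equation

_⊨_ : Valuation → Equation → Set
σ ⊨ mul i j k = σ i * σ j ≡ σ k
σ ⊨ inc i k = σ i + 1 ≡ σ k

_⊨*_ : Valuation → List Equation → Set
σ ⊨* es = All (σ ⊨_) es

Positive : Valuation → Set
Positive σ = ∀ k → 1 ≤ σ k

AgreeBelow : ℕ → Valuation → Valuation → Set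
AgreeBelow b σ τ = ∀ k → k < b → σ k ≡ τ k

AgreeBelow-sym : AgreeBelow b σ τ → AgreeBelow b τ σ
AgreeBelow-sym ag k k<b = sym (ag k k<b)

VarsBelow : ℕ → Equation → Set
VarsBelow b (mul i j k) = i < b × j < b × k < b
VarsBelow b (inc i k) = i < b × k < b

VarsBelow-weaken : b ≤ c → VarsBelow b e → VarsBelow c e
VarsBelow-weaken {e = mul _ _ _} b≤c (i<b , j<b , k<b) =
  <-≤-trans i<b b≤c , <-≤-trans j<b b≤c , <-≤-trans k<b b≤c
VarsBelow-weaken {e = inc _ _} b≤c (i<b , k<b) = <-≤-trans i<b b≤c , <-≤-trans k<b b≤c

⊨-agree : VarsBelow b e → AgreeBelow b σ τ → σ ⊨ e → τ ⊨ e
⊨-agree {e = mul i j k} (i<b , j<b , k<b) ag h =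
  trans (cong₂ _*_ (sym (ag i i<b)) (sym (ag j j<b))) (trans h (ag k k<b))
⊨-agree {e = inc i k} (i<b , k<b) ag h = trans (cong (_+ 1) (sym (ag i i<b))) (trans h (ag k k<b))

⊨*-agree : All (VarsBelow b) es → AgreeBelow b σ τ → σ ⊨* es → τ ⊨* es
⊨*-agree [] ag [] = []
⊨*-agree (vs ∷ vss) ag (h ∷ hs) = ⊨-agree vs ag h ∷ ⊨*-agree vss ag hs

_[_↦_] : Valuation → ℕ → Valuation → Valuation
(ρ [ zero ↦ v ]) k = v k
(ρ [ suc c ↦ v ]) zero = ρ zero
(ρ [ suc c ↦ v ]) (suc k) = ((ρ ∘ suc) [ c ↦ v ]) k

↦-below : ∀ ρ c v → k < c → (ρ [ c ↦ v ]) k ≡ ρ k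
↦-below {zero} ρ (suc c) v _ = refl
↦-below {suc k} ρ (suc c) v (s≤s k<c) = ↦-below (ρ ∘ suc) c v k<c

↦-at : ∀ ρ c v j → (ρ [ c ↦ v ]) (c + j) ≡ v j
↦-at ρ zero v j = refl
↦-at ρ (suc c) v j = ↦-at (ρ ∘ suc) c v j

↦-start : ∀ ρ c v → (ρ [ c ↦ v ]) c ≡ v 0
↦-start ρ c v = trans (cong (ρ [ c ↦ v ]) (sym (+-identityʳ c))) (↦-at ρ c v 0)

↦-positive : Positive ρ → Positive v → Positive (ρ [ c ↦ v ])
↦-positive {c = zero} pρ pv k = pv k
↦-positive {c = suc c} pρ pv zero = pρ zero
↦-positive {c = suc c} pρ pv (suc k) = ↦-positive {c = c} (pρ ∘ suc) pv k

↦-agree : AgreeBelow c σ ρ → (∀ j → j < w → σ (c + j) ≡ v j) → AgreeBelow (c + w) σ (ρ [ c ↦ v ])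
↦-agree {zero} ag fresh k k<w = fresh k k<w
↦-agree {suc c} ag fresh zero _ = ag zero (s≤s z≤n)
↦-agree {suc c} ag fresh (suc k) (s≤s k<c+w) =
  ↦-agree {c} (λ k k<c → ag (suc k) (s≤s k<c)) fresh k k<c+w

-- Gates and straight-line programs

data Gate : Set where
  incG : ℕ → Gate
  mulG addG : ℕ → ℕ → Gate

width : Gate → ℕ
width (incG _) = 1
width (mulG _ _) = 1
width (addG _ _) = 10

ReadsBelow : ℕ → Gate → Set
ReadsBelow c (incG i) = i < c
ReadsBelow c (mulG i j) = i < c × j < c
ReadsBelow c (addG i j) = i < c × j < c

-- The variable c holds z; for z ≥ 1 the last equation, (z x + 1)(z y + 1) = z²(x y + 1) + 1,
-- forces z = x + y (addition-gadget), the others name its intermediate values.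
gateEquations : ℕ → Gate → List Equation
gateEquations c (incG i) = inc i c ∷ []
gateEquations c (mulG i j) = mul i j c ∷ []
gateEquations c (addG i j) =
  mul c i (c + 1) ∷ inc (c + 1) (c + 2) ∷ mul c j (c + 3) ∷ inc (c + 3) (c + 4) ∷
  mul i j (c + 5) ∷ inc (c + 5) (c + 6) ∷ mul c c (c + 7) ∷ mul (c + 7) (c + 6) (c + 8) ∷
  inc (c + 8) (c + 9) ∷ mul (c + 2) (c + 4) (c + 9) ∷ []

addValues : ℕ → ℕ → ℕ → Valuation
addValues z x y 0 = z
addValues z x y 1 = z * x
addValues z x y 2 = z * x + 1
addValues z x y 3 = z * y
addValues z x y 4 = z * y + 1
addValues z x y 5 = x * y
addValues z x y 6 = x * y + 1
addValues z x y 7 = z * z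
addValues z x y 8 = z * z * (x * y + 1)
addValues z x y 9 = z * z * (x * y + 1) + 1
addValues z x y _ = 1

-- The value of variable c + k when the gate sits at c; for k ≥ width g it is junk, but positive.
gateValues : Gate → Valuation → Valuation
gateValues (incG i) ρ _ = ρ i + 1
gateValues (mulG i j) ρ _ = ρ i * ρ j
gateValues (addG i j) ρ = addValues (ρ i + ρ j) (ρ i) (ρ j)

addValues-positive : ∀ {z x y} → 1 ≤ z → 1 ≤ x → 1 ≤ y → Positive (addValues z x y)
addValues-positive pz px py 0 = pz
addValues-positive pz px py 1 = *-mono-≤ pz px
addValues-positive pz px py 2 = m≤n+m 1 _
addValues-positive pz px py 3 = *-mono-≤ pz py
addValues-positive pz px py 4 = m≤n+m 1 _
addValues-positive pz px py 5 = *-mono-≤ px py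
addValues-positive pz px py 6 = m≤n+m 1 _
addValues-positive pz px py 7 = *-mono-≤ pz pz
addValues-positive pz px py 8 = *-mono-≤ (*-mono-≤ pz pz) (m≤n+m 1 _)
addValues-positive pz px py 9 = m≤n+m 1 _
addValues-positive pz px py (suc (suc (suc (suc (suc (suc (suc (suc (suc (suc _)))))))))) =
  s≤s z≤n

gateValues-positive : ∀ g → Positive ρ → Positive (gateValues g ρ)
gateValues-positive (incG i) pρ _ = m≤n+m 1 _
gateValues-positive (mulG i j) pρ _ = *-mono-≤ (pρ i) (pρ j)
gateValues-positive {ρ} (addG i j) pρ =
  addValues-positive (≤-trans (pρ i) (m≤m+n (ρ i) (ρ j))) (pρ i) (pρ j)

addition-gadget : ∀ {z x y} → 1 ≤ z →
                  (z * x + 1) * (z * y + 1) ≡ z * z * (x * y + 1) + 1 → z ≡ x + y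
addition-gadget {z} {x} {y} 1≤z eq = sym (*-cancelˡ-≡ (x + y) z z {{>-nonZero 1≤z}}
  (+-cancelʳ-≡ 1 _ _ (+-cancelˡ-≡ (z * z * (x * y)) _ _ expanded)))
  where
  lhs : ∀ x y z → z * z * (x * y) + (z * (x + y) + 1) ≡ (z * x + 1) * (z * y + 1)
  lhs = solve-∀
  rhs : ∀ x y z → z * z * (x * y + 1) + 1 ≡ z * z * (x * y) + (z * z + 1)
  rhs = solve-∀
  expanded : z * z * (x * y) + (z * (x + y) + 1) ≡ z * z * (x * y) + (z * z + 1)
  expanded = trans (lhs x y z) (trans eq (rhs x y z))

addG-sound : ∀ {σ c i j} → (∀ k → σ (c + k) ≡ addValues (σ i + σ j) (σ i) (σ j) k) →
             σ ⊨* gateEquations c (addG i j)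
addG-sound {σ} {c} {i} {j} at =
  byMul at₀ refl (at 1) ∷ byInc (at 1) (at 2) ∷ byMul at₀ refl (at 3) ∷ byInc (at 3) (at 4) ∷
  byMul refl refl (at 5) ∷ byInc (at 5) (at 6) ∷ byMul at₀ at₀ (at 7) ∷ byMul (at 7) (at 6) (at 8) ∷
  byInc (at 8) (at 9) ∷ trans (cong₂ _*_ (at 2) (at 4)) (trans (gadget-identity (σ i) (σ j)) (sym (at 9))) ∷ []
  where
  byMul : ∀ {a b d a′ b′} → σ a ≡ a′ → σ b ≡ b′ → σ d ≡ a′ * b′ → σ a * σ b ≡ σ d
  byMul p q r = trans (cong₂ _*_ p q) (sym r)
  byInc : ∀ {a d a′} → σ a ≡ a′ → σ d ≡ a′ + 1 → σ a + 1 ≡ σ d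
  byInc p r = trans (cong (_+ 1) p) (sym r)
  gadget-identity : ∀ x y →
    ((x + y) * x + 1) * ((x + y) * y + 1) ≡ (x + y) * (x + y) * (x * y + 1) + 1
  gadget-identity = solve-∀
  at₀ : σ c ≡ σ i + σ j
  at₀ = trans (cong σ (sym (+-identityʳ c))) (at 0)

addG-values : ∀ {σ c i j} → σ ⊨* gateEquations c (addG i j) →
              ∀ k → k < 10 → σ (c + k) ≡ addValues (σ c) (σ i) (σ j) k
addG-values {σ} {c} (e₁ ∷ e₂ ∷ e₃ ∷ e₄ ∷ e₅ ∷ e₆ ∷ e₇ ∷ e₈ ∷ e₉ ∷ _ ∷ []) = values
  where
  v₆ = trans (sym e₆) (cong (_+ 1) (sym e₅))
  v₈ = trans (sym e₈) (cong₂ _*_ (sym e₇) v₆)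
  values : ∀ k → k < 10 → σ (c + k) ≡ addValues (σ c) _ _ k
  values 0 _ = cong σ (+-identityʳ c)
  values 1 _ = sym e₁
  values 2 _ = trans (sym e₂) (cong (_+ 1) (sym e₁))
  values 3 _ = sym e₃
  values 4 _ = trans (sym e₄) (cong (_+ 1) (sym e₃))
  values 5 _ = sym e₅
  values 6 _ = v₆
  values 7 _ = sym e₇
  values 8 _ = v₈
  values 9 _ = trans (sym e₉) (cong (_+ 1) v₈)
  values (suc (suc (suc (suc (suc (suc (suc (suc (suc (suc _))))))))))
         (s≤s (s≤s (s≤s (s≤s (s≤s (s≤s (s≤s (s≤s (s≤s (s≤s ()))))))))))

addG-sum : ∀ {σ c i j} → Positive σ → σ ⊨* gateEquations c (addG i j) → σ c ≡ σ i + σ j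
addG-sum {σ} {c} pσ es@(_ ∷ _ ∷ _ ∷ _ ∷ _ ∷ _ ∷ _ ∷ _ ∷ _ ∷ gadget ∷ []) =
  addition-gadget (pσ c) (trans (sym (cong₂ _*_ (at 2 lit) (at 4 lit))) (trans gadget (at 9 lit)))
  where
  at = addG-values es
  lit : ∀ {k} {k<10 : True (k <? 10)} → k < 10
  lit {k<10 = k<10} = toWitness k<10

data BinOp : Set where
  plus times : BinOp

apply : BinOp → ℕ → ℕ → ℕ
apply plus = _+_
apply times = _*_

binGate : BinOp → ℕ → ℕ → Gate
binGate plus = addG
binGate times = mulG

binGate-output : ∀ o → Positive σ → σ ⊨* gateEquations c (binGate o i j) →
                 σ c ≡ apply o (σ i) (σ j)
binGate-output plus pσ es = addG-sum pσ es
binGate-output times pσ (e ∷ []) = sym e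

gate-sound : ∀ {c ρ} g → ReadsBelow c g → (ρ [ c ↦ gateValues g ρ ]) ⊨* gateEquations c g
gate-sound {c} {ρ} (incG i) i<c =
  trans (cong (_+ 1) (↦-below ρ c _ i<c)) (sym (↦-start ρ c _)) ∷ []
gate-sound {c} {ρ} (mulG i j) (i<c , j<c) =
  trans (cong₂ _*_ (↦-below ρ c _ i<c) (↦-below ρ c _ j<c)) (sym (↦-start ρ c _)) ∷ []
gate-sound {c} {ρ} (addG i j) (i<c , j<c) = addG-sound λ k →
  trans (↦-at ρ c _ k)
        (cong₂ (λ x y → addValues (x + y) x y k) (sym (↦-below ρ c _ i<c)) (sym (↦-below ρ c _ j<c)))

gate-determined : ∀ {c σ ρ} g → ReadsBelow c g → Positive σ → AgreeBelow c σ ρ →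
                  σ ⊨* gateEquations c g → ∀ k → k < width g → σ (c + k) ≡ gateValues g ρ k
gate-determined {c} {σ} (incG i) i<c _ ag (e ∷ []) zero _ =
  trans (cong σ (+-identityʳ c)) (trans (sym e) (cong (_+ 1) (ag i i<c)))
gate-determined {c} {σ} (mulG i j) (i<c , j<c) _ ag (e ∷ []) zero _ =
  trans (cong σ (+-identityʳ c)) (trans (sym e) (cong₂ _*_ (ag i i<c) (ag j j<c)))
gate-determined (incG _) _ _ _ _ (suc _) (s≤s ())
gate-determined (mulG _ _) _ _ _ _ (suc _) (s≤s ())
gate-determined {c} {σ} (addG i j) (i<c , j<c) pσ ag es k k<10 =
  trans (addG-values es k k<10)
        (trans (cong (λ z → addValues z (σ i) (σ j) k) (addG-sum pσ es))
               (cong₂ (λ x y → addValues (x + y) x y k) (ag i i<c) (ag j j<c)))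

gate-within : ∀ {c} g → ReadsBelow c g → All (VarsBelow (c + width g)) (gateEquations c g)
gate-within {c} (incG i) i<c = (m≤n⇒m≤n+o 1 i<c , m<m+n c (s≤s z≤n)) ∷ []
gate-within {c} (mulG i j) (i<c , j<c) =
  (m≤n⇒m≤n+o 1 i<c , m≤n⇒m≤n+o 1 j<c , m<m+n c (s≤s z≤n)) ∷ []
gate-within {c} (addG i j) (i<c , j<c) =
  (start , old i<c , new 1) ∷ (new 1 , new 2) ∷ (start , old j<c , new 3) ∷ (new 3 , new 4) ∷
  (old i<c , old j<c , new 5) ∷ (new 5 , new 6) ∷ (start , start , new 7) ∷
  (new 7 , new 6 , new 8) ∷
  (new 8 , new 9) ∷ (new 2 , new 4 , new 9) ∷ []
  where
  start : c < c + 10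
  start = m<m+n c (s≤s z≤n)
  old : ∀ {a} → a < c → a < c + 10
  old = m≤n⇒m≤n+o 10
  new : ∀ k {k<10 : True (k <? 10)} → c + k < c + 10
  new k {k<10} = +-monoʳ-< c (toWitness k<10)

infixr 5 _⨾_
data Program : Set where
  skip : Program
  gate : Gate → Program
  _⨾_ : Program → Program → Program

size : Program → ℕ
size skip = 0
size (gate g) = width g
size (p ⨾ q) = size p + size q

equations : ℕ → Program → List Equation
equations c skip = []
equations c (gate g) = gateEquations c g
equations c (p ⨾ q) = equations c p ++ equations (c + size p) q

run : ℕ → Program → Valuation → Valuation
run c skip ρ = ρ
run c (gate g) ρ = ρ [ c ↦ gateValues g ρ ]
run c (p ⨾ q) ρ = run (c + size p) q (run c p ρ)

WellFormed : ℕ → Program → Set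
WellFormed c skip = ⊤
WellFormed c (gate g) = ReadsBelow c g
WellFormed c (p ⨾ q) = WellFormed c p × WellFormed (c + size p) q

run-below : ∀ {c ρ k} p → k < c → run c p ρ k ≡ ρ k
run-below skip _ = refl
run-below {c} {ρ} (gate g) k<c = ↦-below ρ c _ k<c
run-below {c} (p ⨾ q) k<c = trans (run-below q (m≤n⇒m≤n+o (size p) k<c)) (run-below p k<c)

run-positive : ∀ {c ρ} p → Positive ρ → Positive (run c p ρ)
run-positive skip pρ = pρ
run-positive {c} (gate g) pρ = ↦-positive {c = c} pρ (gateValues-positive g pρ)
run-positive (p ⨾ q) pρ = run-positive q (run-positive p pρ)

equations-within : ∀ {c} p → WellFormed c p → All (VarsBelow (c + size p)) (equations c p)
equations-within skip _ = []
equations-within (gate g) wf = gate-within g wf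
equations-within {c} (p ⨾ q) (wp , wq) = All.++⁺
  (All.map (VarsBelow-weaken (+-monoʳ-≤ c (m≤m+n (size p) (size q)))) (equations-within p wp))
  (subst (λ b → All (VarsBelow b) (equations (c + size p) q)) (+-assoc c (size p) (size q))
         (equations-within q wq))

run-sound : ∀ {c ρ} p → WellFormed c p → run c p ρ ⊨* equations c p
run-sound skip _ = []
run-sound (gate g) wf = gate-sound g wf
run-sound (p ⨾ q) (wp , wq) = All.++⁺
  (⊨*-agree (equations-within p wp) (λ _ k<c → sym (run-below q k<c)) (run-sound p wp))
  (run-sound q wq)

run-determined : ∀ {c σ ρ} p → WellFormed c p → Positive σ → AgreeBelow c σ ρ →
                 σ ⊨* equations c p → AgreeBelow (c + size p) σ (run c p ρ)
run-determined {c} skip _ _ ag _ k k<c = ag k (subst (k <_) (+-identityʳ c) k<c)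
run-determined (gate g) wf pσ ag es = ↦-agree ag (gate-determined g wf pσ ag es)
run-determined {c} (p ⨾ q) (wp , wq) pσ ag es k k<c =
  run-determined q wq pσ (run-determined p wp pσ ag (All.++⁻ˡ (equations c p) es))
                 (All.++⁻ʳ (equations c p) es) k
                 (subst (k <_) (sym (+-assoc c (size p) (size q))) k<c)

padding : ℕ → Program
padding zero = skip
padding (suc k) = gate (mulG 0 0) ⨾ padding k

size-padding : ∀ k → size (padding k) ≡ k
size-padding zero = refl
size-padding (suc k) = cong suc (size-padding k)

padding-wellFormed : ∀ k → 0 < c → WellFormed c (padding k)
padding-wellFormed zero _ = tt
padding-wellFormed (suc k) 0<c = (0<c , 0<c) , padding-wellFormed k (m≤n⇒m≤n+o 1 0<c)

-- Expressions

data Expr : Set where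
  one : Expr
  input : ℕ → Expr
  succ : Expr → Expr
  node : BinOp → Expr → Expr → Expr

infixl 6 _⊞_
infixl 7 _⊠_
pattern _⊞_ a b = node plus a b
pattern _⊠_ a b = node times a b

⟦_⟧ : Expr → Valuation → ℕ
⟦ one ⟧ σ = 1
⟦ input i ⟧ σ = σ i
⟦ succ a ⟧ σ = ⟦ a ⟧ σ + 1
⟦ node o a b ⟧ σ = apply o (⟦ a ⟧ σ) (⟦ b ⟧ σ)

opWidth : BinOp → ℕ
opWidth plus = 10
opWidth times = 1

width-binGate : ∀ o → width (binGate o i j) ≡ opWidth o
width-binGate plus = refl
width-binGate times = refl

exprSize : Expr → ℕ
exprSize one = 0
exprSize (input _) = 0
exprSize (succ a) = exprSize a + 1
exprSize (node o a b) = exprSize a + (exprSize b + opWidth o)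

-- The variable 0 is reserved for the constant 1.
code : Expr → ℕ → Program
out : Expr → ℕ → ℕ

code one c = skip
code (input i) c = skip
code (succ a) c = code a c ⨾ gate (incG (out a c))
code (node o a b) c = code a c ⨾ (code b c′ ⨾ gate (binGate o (out a c) (out b c′)))
  where c′ = c + size (code a c)

out one c = 0
out (input i) c = i
out (succ a) c = c + size (code a c)
out (node o a b) c = c′ + size (code b c′)
  where c′ = c + size (code a c)

code-size : ∀ e c → size (code e c) ≡ exprSize e
code-size one c = refl
code-size (input i) c = refl
code-size (succ a) c = cong (_+ 1) (code-size a c)
code-size (node o a b) c =
  cong₂ _+_ (code-size a c) (cong₂ _+_ (code-size b (c + size (code a c))) (width-binGate o))

InputsBelow : ℕ → Expr → Set
InputsBelow c one = ⊤
InputsBelow c (input i) = i < c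
InputsBelow c (succ a) = InputsBelow c a
InputsBelow c (node o a b) = InputsBelow c a × InputsBelow c b

InputsBelow-weaken : c ≤ b → ∀ e → InputsBelow c e → InputsBelow b e
InputsBelow-weaken c≤b one _ = tt
InputsBelow-weaken c≤b (input i) i<c = <-≤-trans i<c c≤b
InputsBelow-weaken c≤b (succ a) ia = InputsBelow-weaken c≤b a ia
InputsBelow-weaken c≤b (node o a b) (ia , ib) =
  InputsBelow-weaken c≤b a ia , InputsBelow-weaken c≤b b ib

binGate-reads : ∀ o → i < c → j < c → ReadsBelow c (binGate o i j)
binGate-reads plus i<c j<c = i<c , j<c
binGate-reads times i<c j<c = i<c , j<c

out-bound : ∀ {c} e → 0 < c → InputsBelow c e → out e c < c + size (code e c)
out-bound one 0<c _ = m≤n⇒m≤n+o 0 0<c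
out-bound (input i) _ i<c = m≤n⇒m≤n+o 0 i<c
out-bound {c} (succ a) _ _ = +-monoʳ-< c (m<m+n (size (code a c)) (s≤s z≤n))
out-bound {c} (node o a b) _ _ =
  subst (_< c + (sa + (sb + gw))) (sym (+-assoc c sa sb))
        (+-monoʳ-< c (+-monoʳ-< sa (m<m+n sb width>0)))
  where
  sa = size (code a c)
  sb = size (code b (c + sa))
  gw = width (binGate o (out a c) (out b (c + sa)))
  width>0 : 0 < gw
  width>0 = subst (0 <_) (sym (width-binGate o)) (opWidth>0 o)
    where
    opWidth>0 : ∀ o → 0 < opWidth o
    opWidth>0 plus = s≤s z≤n
    opWidth>0 times = s≤s z≤n

code-wellFormed : ∀ {c} e → 0 < c → InputsBelow c e → WellFormed c (code e c)
code-wellFormed one _ _ = tt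
code-wellFormed (input i) _ _ = tt
code-wellFormed (succ a) 0<c ia = code-wellFormed a 0<c ia , out-bound a 0<c ia
code-wellFormed {c} (node o a b) 0<c (ia , ib) =
  code-wellFormed a 0<c ia ,
  code-wellFormed b 0<c′ ib′ ,
  binGate-reads o (m≤n⇒m≤n+o _ (out-bound a 0<c ia)) (out-bound b 0<c′ ib′)
  where
  c′ = c + size (code a c)
  0<c′ = m≤n⇒m≤n+o (size (code a c)) 0<c
  ib′ = InputsBelow-weaken (m≤m+n c (size (code a c))) b ib

out-value : ∀ {σ} e c → σ 0 ≡ 1 → Positive σ → σ ⊨* equations c (code e c) →
            σ (out e c) ≡ ⟦ e ⟧ σ
out-value one c σ0 _ _ = σ0
out-value (input i) c _ _ _ = refl
out-value (succ a) c σ0 pσ es with All.++⁻ (equations c (code a c)) es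
... | esa , e ∷ [] = trans (sym e) (cong (_+ 1) (out-value a c σ0 pσ esa))
out-value (node o a b) c σ0 pσ es with All.++⁻ (equations c (code a c)) es
... | esa , esr with All.++⁻ (equations (c + size (code a c)) (code b (c + size (code a c)))) esr
... | esb , esg =
  trans (binGate-output o pσ esg) (cong₂ (apply o) (out-value a c σ0 pσ esa) (out-value b _ σ0 pσ esb))

constant : ℕ → Expr
constant zero = one
constant (suc k) = succ (constant k)

constant-value : ∀ k → ⟦ constant k ⟧ σ ≡ suc k
constant-value zero = refl
constant-value (suc k) = trans (cong (_+ 1) (constant-value k)) (+-comm (suc k) 1)

constant-inputs : ∀ k → InputsBelow c (constant k)
constant-inputs zero = tt
constant-inputs (suc k) = constant-inputs k

-- Polynomials as differences of expressions

-- With ⟦ ι i ⟧ = aᵢ + 1, eval t a = ⟦ plusPart ι t ⟧ − ⟦ minusPart ι t ⟧ (split-eval).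
plusPart minusPart : ∀ {v} → (Fin v → Expr) → Poly v → Expr
plusPart ι (var i) = ι i
plusPart ι (con (+ k)) = constant k
plusPart ι (con -[1+ k ]) = one
plusPart ι (p ⊕ q) = plusPart ι p ⊞ plusPart ι q
plusPart ι (p ⊗ q) = plusPart ι p ⊠ plusPart ι q ⊞ minusPart ι p ⊠ minusPart ι q
minusPart ι (var i) = one
minusPart ι (con (+ k)) = one
minusPart ι (con -[1+ k ]) = constant (suc k)
minusPart ι (p ⊕ q) = minusPart ι p ⊞ minusPart ι q
minusPart ι (p ⊗ q) = plusPart ι p ⊠ minusPart ι q ⊞ minusPart ι p ⊠ plusPart ι q

sum-split : ∀ x y m n {p q : ℤ} → x ℤ.+ m ≡ p → y ℤ.+ n ≡ q →
            (x ℤ.+ y) ℤ.+ (m ℤ.+ n) ≡ p ℤ.+ q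
sum-split x y m n refl refl = identity x y m n
  where
  identity : ∀ x y m n → (x ℤ.+ y) ℤ.+ (m ℤ.+ n) ≡ (x ℤ.+ m) ℤ.+ (y ℤ.+ n)
  identity = ℤ-Solver.solve-∀

product-split : ∀ x y m n {p q : ℤ} → x ℤ.+ m ≡ p → y ℤ.+ n ≡ q →
                x ℤ.* y ℤ.+ (p ℤ.* n ℤ.+ m ℤ.* q) ≡ p ℤ.* q ℤ.+ m ℤ.* n
product-split x y m n refl refl = identity x y m n
  where
  identity : ∀ x y m n →
    x ℤ.* y ℤ.+ ((x ℤ.+ m) ℤ.* n ℤ.+ m ℤ.* (y ℤ.+ n)) ≡ (x ℤ.+ m) ℤ.* (y ℤ.+ n) ℤ.+ m ℤ.* n
  identity = ℤ-Solver.solve-∀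

pos-*+* : ∀ a b c d → + (a * b + c * d) ≡ + a ℤ.* + b ℤ.+ + c ℤ.* + d
pos-*+* a b c d =
  trans (ℤₚ.pos-+ (a * b) (c * d)) (cong₂ ℤ._+_ (ℤₚ.pos-* a b) (ℤₚ.pos-* c d))

split-eval : ∀ {v σ} (ι : Fin v → Expr) (a : Vec ℕ v) →
             (∀ i → ⟦ ι i ⟧ σ ≡ suc (lookup a i)) →
             ∀ t → eval t (Vec.map +_ a) ℤ.+ + ⟦ minusPart ι t ⟧ σ ≡ + ⟦ plusPart ι t ⟧ σ
split-eval ι a ιa (var i) =
  trans (cong (ℤ._+ + 1) (lookup-map i +_ a)) (cong +_ (trans (+-comm (lookup a i) 1) (sym (ιa i))))
split-eval ι a ιa (con (+ k)) = cong +_ (trans (+-comm k 1) (sym (constant-value k)))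
split-eval {σ = σ} ι a ιa (con -[1+ k ]) =
  trans (cong (λ n → -[1+ k ] ℤ.+ + n) (constant-value {σ = σ} (suc k))) (identity (+ k))
  where
  identity : ∀ x → ℤ.- (+ 1 ℤ.+ x) ℤ.+ (+ 2 ℤ.+ x) ≡ + 1
  identity = ℤ-Solver.solve-∀
split-eval {σ = σ} ι a ιa (p ⊕ q) =
  sum-split (eval p vals) (eval q vals) (+ ⟦ minusPart ι p ⟧ σ) (+ ⟦ minusPart ι q ⟧ σ)
            (split-eval ι a ιa p) (split-eval ι a ιa q)
  where vals = Vec.map +_ a
split-eval {σ = σ} ι a ιa (p ⊗ q) = begin
  eval p vals ℤ.* eval q vals ℤ.+ + (P₁ * N₂ + N₁ * P₂)
    ≡⟨ cong (λ n → eval p vals ℤ.* eval q vals ℤ.+ n) (pos-*+* P₁ N₂ N₁ P₂) ⟩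
  eval p vals ℤ.* eval q vals ℤ.+ (+ P₁ ℤ.* + N₂ ℤ.+ + N₁ ℤ.* + P₂)
    ≡⟨ product-split (eval p vals) (eval q vals) (+ N₁) (+ N₂) (split-eval ι a ιa p) (split-eval ι a ιa q) ⟩
  + P₁ ℤ.* + P₂ ℤ.+ + N₁ ℤ.* + N₂
    ≡⟨ pos-*+* P₁ P₂ N₁ N₂ ⟨
  + (P₁ * P₂ + N₁ * N₂)
    ∎
  where
  open ≡-Reasoning
  vals = Vec.map +_ a
  P₁ = ⟦ plusPart ι p ⟧ σ
  P₂ = ⟦ plusPart ι q ⟧ σ
  N₁ = ⟦ minusPart ι p ⟧ σ
  N₂ = ⟦ minusPart ι q ⟧ σ

split-inputs : ∀ {v c} (ι : Fin v → Expr) → (∀ i → InputsBelow c (ι i)) →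
               ∀ t → InputsBelow c (plusPart ι t) × InputsBelow c (minusPart ι t)
split-inputs ι ιc (var i) = ιc i , tt
split-inputs ι ιc (con (+ k)) = constant-inputs k , tt
split-inputs ι ιc (con -[1+ k ]) = tt , constant-inputs (suc k)
split-inputs ι ιc (p ⊕ q) = Product.zip _,_ _,_ (split-inputs ι ιc p) (split-inputs ι ιc q)
split-inputs ι ιc (p ⊗ q) = ((p⁺ , q⁺) , (p⁻ , q⁻)) , ((p⁺ , q⁻) , (p⁻ , q⁺))
  where
  p⁺ = proj₁ (split-inputs ι ιc p)
  p⁻ = proj₂ (split-inputs ι ιc p)
  q⁺ = proj₁ (split-inputs ι ιc q)
  q⁻ = proj₂ (split-inputs ι ιc q)

node-size-cong : ∀ o {x x′ y y′} → x ≡ x′ → y ≡ y′ →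
                 x + (y + opWidth o) ≡ x′ + (y′ + opWidth o)
node-size-cong o = cong₂ (λ x y → x + (y + opWidth o))

split-size : ∀ {v} (ι ι′ : Fin v → Expr) → (∀ i → exprSize (ι i) ≡ exprSize (ι′ i)) → ∀ t →
             exprSize (plusPart ι t) ≡ exprSize (plusPart ι′ t) ×
             exprSize (minusPart ι t) ≡ exprSize (minusPart ι′ t)
split-size ι ι′ same (var i) = same i , refl
split-size ι ι′ same (con (+ k)) = refl , refl
split-size ι ι′ same (con -[1+ k ]) = refl , refl
split-size ι ι′ same (p ⊕ q) =
  Product.zip (node-size-cong plus) (node-size-cong plus) (split-size ι ι′ same p) (split-size ι ι′ same q)
split-size ι ι′ same (p ⊗ q) =
  node-size-cong plus (node-size-cong times p⁺ q⁺) (node-size-cong times p⁻ q⁻) ,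
  node-size-cong plus (node-size-cong times p⁺ q⁻) (node-size-cong times p⁻ q⁺)
  where
  p⁺ = proj₁ (split-size ι ι′ same p)
  p⁻ = proj₂ (split-size ι ι′ same p)
  q⁺ = proj₁ (split-size ι ι′ same q)
  q⁻ = proj₂ (split-size ι ι′ same q)

difference-zero : ∀ {x : ℤ} {m n} → x ℤ.+ + n ≡ + m → x ≡ + 0 ⇔ m ≡ n
difference-zero {x} {m} {n} eq =
  mk⇔ (λ { refl → sym (ℤₚ.+-injective eq) }) (λ { refl → identityˡ-unique x (+ n) eq })

-- Binary numerals

two : Expr
two = succ one

binary : ℕᵇ → Expr
binary ℕᵇ.zero = one
binary 2[1+ b ] = succ (binary b ⊠ two)
binary 1+[2 b ] = binary b ⊠ two

binary-value : ∀ b → ⟦ binary b ⟧ σ ≡ suc (ℕᵇ.toℕ b)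
binary-value ℕᵇ.zero = refl
binary-value 2[1+ b ] = trans (cong (λ x → x * 2 + 1) (binary-value b)) (identity (ℕᵇ.toℕ b))
  where
  identity : ∀ t → suc t * 2 + 1 ≡ suc (2 * suc t)
  identity = solve-∀
binary-value 1+[2 b ] = trans (cong (_* 2) (binary-value b)) (identity (ℕᵇ.toℕ b))
  where
  identity : ∀ t → suc t * 2 ≡ suc (suc (2 * t))
  identity = solve-∀

binary-inputs : ∀ b → InputsBelow c (binary b)
binary-inputs ℕᵇ.zero = tt
binary-inputs 2[1+ b ] = binary-inputs b , tt
binary-inputs 1+[2 b ] = binary-inputs b , tt

+3≤3*suc : ∀ {s k} → s ≤ 3 * k → s + 3 ≤ 3 * suc k
+3≤3*suc {s} {k} s≤3k =
  subst (s + 3 ≤_) (trans (+-comm (3 * k) 3) (sym (*-suc 3 k))) (+-monoˡ-≤ 3 s≤3k)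

binary-size : ∀ b → exprSize (binary b) ≤ 3 * ℕᵇ.size b
binary-size ℕᵇ.zero = z≤n
binary-size 2[1+ b ] =
  subst (_≤ 3 * suc (ℕᵇ.size b)) (sym (+-assoc _ 2 1)) (+3≤3*suc (binary-size b))
binary-size 1+[2 b ] = ≤-trans (+-monoʳ-≤ _ (n≤1+n 2)) (+3≤3*suc (binary-size b))

2^size≤1+toℕ : ∀ b → 2 ^ ℕᵇ.size b ≤ suc (ℕᵇ.toℕ b)
2^size≤1+toℕ ℕᵇ.zero = ≤-refl
2^size≤1+toℕ 2[1+ b ] = ≤-trans (*-monoʳ-≤ 2 (2^size≤1+toℕ b)) (n≤1+n _)
2^size≤1+toℕ 1+[2 b ] = ≤-trans (*-monoʳ-≤ 2 (2^size≤1+toℕ b)) (≤-reflexive (*-suc 2 (ℕᵇ.toℕ b)))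

6*k≤2^k+10 : ∀ k → 6 * k ≤ 2 ^ k + 10
6*k≤2^k+10 0 = z≤n
6*k≤2^k+10 1 = ≤ᵇ⇒≤ 6 12 tt
6*k≤2^k+10 2 = ≤ᵇ⇒≤ 12 14 tt
6*k≤2^k+10 3 = ≤-refl
6*k≤2^k+10 (suc (suc (suc (suc j)))) = begin
  6 * (4 + j)                        ≡⟨ *-suc 6 (3 + j) ⟩
  6 + 6 * (3 + j)                    ≤⟨ +-mono-≤ 6≤2^[3+j] (6*k≤2^k+10 (suc (suc (suc j)))) ⟩
  2 ^ (3 + j) + (2 ^ (3 + j) + 10)   ≡⟨ doubling (2 ^ (3 + j)) ⟩
  2 ^ (4 + j) + 10                   ∎
  where
  open ≤-Reasoning
  6≤2^[3+j] : 6 ≤ 2 ^ (3 + j)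
  6≤2^[3+j] = ≤-trans (≤ᵇ⇒≤ 6 8 tt) (^-monoʳ-≤ 2 (m≤m+n 3 j))
  doubling : ∀ p → p + (p + 10) ≡ 2 * p + 10
  doubling = solve-∀

binary-fromℕ-size : ∀ n → 2 * exprSize (binary (ℕᵇ.fromℕ n)) ≤ n + 11
binary-fromℕ-size n = begin
  2 * exprSize (binary nᵇ)   ≤⟨ *-monoʳ-≤ 2 (binary-size nᵇ) ⟩
  2 * (3 * ℕᵇ.size nᵇ)       ≡⟨ *-assoc 2 3 (ℕᵇ.size nᵇ) ⟨
  6 * ℕᵇ.size nᵇ             ≤⟨ 6*k≤2^k+10 (ℕᵇ.size nᵇ) ⟩
  2 ^ ℕᵇ.size nᵇ + 10        ≤⟨ +-monoˡ-≤ 10 (2^size≤1+toℕ nᵇ) ⟩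
  suc (ℕᵇ.toℕ nᵇ) + 10       ≡⟨ cong (λ t → suc t + 10) (toℕ-fromℕ n) ⟩
  suc n + 10                ≡⟨ +-suc n 10 ⟨
  n + 11                    ∎
  where
  open ≤-Reasoning
  nᵇ = ℕᵇ.fromℕ n

-- Systems in E_n

-- Positions beyond the last one are read as the last entry.
clamp : ∀ {n} → ℕ → Fin (suc n)
clamp zero = zero
clamp {zero} (suc k) = zero
clamp {suc n} (suc k) = suc (clamp k)

toℕ-clamp : ∀ {n k} → k ≤ n → toℕ (clamp {n} k) ≡ k
toℕ-clamp {k = zero} _ = refl
toℕ-clamp {suc n} {suc k} (s≤s k≤n) = cong suc (toℕ-clamp k≤n)

clamp-toℕ : ∀ {n} (i : Fin (suc n)) → clamp (toℕ i) ≡ i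
clamp-toℕ zero = refl
clamp-toℕ {suc n} (suc i) = cong suc (clamp-toℕ i)

valuation : ∀ {n} → Vec ℕ (suc n) → Valuation
valuation x k = lookup x (clamp k)

valuation-positive : ∀ {n} {x : Vec ℕ (suc n)} → VecAll.All (1 ≤_) x → Positive (valuation x)
valuation-positive px k = VecAll.lookup⁺ px (clamp k)

valuation-agrees : ∀ {n τ} {x : Vec ℕ (suc n)} → (∀ i → lookup x i ≡ τ (toℕ i)) →
                   AgreeBelow (suc n) (valuation x) τ
valuation-agrees {τ = τ} x≡τ k (s≤s k≤n) = trans (x≡τ (clamp k)) (cong τ (toℕ-clamp k≤n))

agree⇒≡tabulate : ∀ {n τ} {x : Vec ℕ (suc n)} → AgreeBelow (suc n) (valuation x) τ →
                  x ≡ tabulate (τ ∘ toℕ)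
agree⇒≡tabulate {x = x} ag = trans (sym (tabulate∘lookup x)) (tabulate-cong λ i →
  trans (cong (lookup x) (sym (clamp-toℕ i))) (ag (toℕ i) (toℕ<n i)))

tabulate-positive : ∀ {n} → Positive τ → VecAll.All (1 ≤_) (tabulate {n = n} (τ ∘ toℕ))
tabulate-positive {τ} pτ =
  VecAll.lookup⁻ λ i → subst (1 ≤_) (sym (lookup∘tabulate (τ ∘ toℕ) i)) (pτ (toℕ i))

toEqn : ∀ {n} → Equation → Eqn (suc n)
toEqn (mul i j k) = mulEq (clamp i) (clamp j) (clamp k)
toEqn (inc i k) = sucEq (clamp i) (clamp k)

⊨*⇒holds : ∀ {n} {x : Vec ℕ (suc n)} → valuation x ⊨* es → All (Holds x) (List.map toEqn es)
⊨*⇒holds = All.map⁺ ∘ All.map λ {e} → ⊨⇒holds e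
  where
  ⊨⇒holds : ∀ {n} {x : Vec ℕ (suc n)} e → valuation x ⊨ e → Holds x (toEqn e)
  ⊨⇒holds (mul _ _ _) h = h
  ⊨⇒holds (inc _ _) h = h

holds⇒⊨* : ∀ {n} {x : Vec ℕ (suc n)} → All (Holds x) (List.map toEqn es) → valuation x ⊨* es
holds⇒⊨* = All.map (λ {e} → holds⇒⊨ e) ∘ All.map⁻
  where
  holds⇒⊨ : ∀ {n} {x : Vec ℕ (suc n)} e → Holds x (toEqn e) → valuation x ⊨ e
  holds⇒⊨ (mul _ _ _) h = h
  holds⇒⊨ (inc _ _) h = h

n*n≡n⇒n≡1 : ∀ {a} → 1 ≤ a → a * a ≡ a → a ≡ 1
n*n≡n⇒n≡1 {a} 1≤a a²≡a = *-cancelˡ-≡ a 1 a {{>-nonZero 1≤a}} (trans a²≡a (sym (*-identityʳ a)))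

splitSize : ∀ {v} → Poly v → ℕ
splitSize W = exprSize (plusPart (λ _ → one) W) + exprSize (minusPart (λ _ → one) W)

threshold : ∀ {s} → Poly (suc s) → ℕ
threshold {s} W = 11 + 2 * (suc s + splitSize W)

record Simulation {s} (W : Poly (suc s)) (n : ℕ) : Set where
  field
    system : System n
    embed : Vec ℕ s → Vec ℕ n
    embed-sol : ∀ u → Zero W (n ∷ []) u → Sol system (embed u)
    sol-embed : ∀ x → Sol system x → ∃ λ u → Zero W (n ∷ []) u × x ≡ embed u
    embed-bounded : ∀ {b} u → VecAll.All (_≤ b) (embed u) → VecAll.All (_< b) u

-- Layout: x₀ = 1 and x₁₊ᵢ = uᵢ + 1, followed by the code for n + 1, W⁺ and W⁻, padded to n variables.
module Construction {s : ℕ} (W : Poly (suc s)) (n′ : ℕ) (large : threshold W < suc n′) where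

  n : ℕ
  n = suc n′

  c₀ : ℕ
  c₀ = suc s

  E : Expr
  E = binary (ℕᵇ.fromℕ n)

  c₁ : ℕ
  c₁ = c₀ + size (code E c₀)

  ι : Fin (suc s) → Expr
  ι zero = input (out E c₀)
  ι (suc i) = input (suc (toℕ i))

  P N : Expr
  P = plusPart ι W
  N = minusPart ι W

  c₂ c₃ : ℕ
  c₂ = c₁ + size (code P c₁)
  c₃ = c₂ + size (code N c₂)

  program : Program
  program = code E c₀ ⨾ code P c₁ ⨾ code N c₂ ⨾ padding (n ∸ c₃)

  constraints : List Equation
  constraints = mul 0 0 0 ∷ mul (out P c₁) 0 (out N c₂) ∷ equations c₀ program

  inputs : Vec ℕ s → Valuation
  inputs u = valuation (1 ∷ Vec.map suc u)

  canonical : Vec ℕ s → Valuation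
  canonical u = run c₀ program (inputs u)

  0<c₀ : 0 < c₀
  0<c₀ = s≤s z≤n

  ι-inputs : ∀ i → InputsBelow c₁ (ι i)
  ι-inputs zero = out-bound E 0<c₀ (binary-inputs (ℕᵇ.fromℕ n))
  ι-inputs (suc i) = <-≤-trans (s≤s (toℕ<n i)) (m≤m+n c₀ _)

  0<c₁ : 0 < c₁
  0<c₁ = m≤n⇒m≤n+o _ 0<c₀

  0<c₂ : 0 < c₂
  0<c₂ = m≤n⇒m≤n+o _ 0<c₁

  P-inputs : InputsBelow c₁ P
  P-inputs = proj₁ (split-inputs ι ι-inputs W)

  N-inputs : InputsBelow c₂ N
  N-inputs = InputsBelow-weaken (m≤m+n c₁ _) N (proj₂ (split-inputs ι ι-inputs W))

  program-wellFormed : WellFormed c₀ program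
  program-wellFormed =
    code-wellFormed E 0<c₀ (binary-inputs (ℕᵇ.fromℕ n)) ,
    code-wellFormed P 0<c₁ P-inputs ,
    code-wellFormed N 0<c₂ N-inputs ,
    padding-wellFormed (n ∸ c₃) (m≤n⇒m≤n+o _ 0<c₂)

  c₃≡ : c₃ ≡ c₀ + splitSize W + exprSize E
  c₃≡ = begin
    c₀ + size (code E c₀) + size (code P c₁) + size (code N c₂)
      ≡⟨ cong₂ (λ x y → c₀ + size (code E c₀) + x + y)
               (trans (code-size P c₁) (proj₁ sizes)) (trans (code-size N c₂) (proj₂ sizes)) ⟩
    c₀ + size (code E c₀) + P₀ + N₀  ≡⟨ cong (λ x → c₀ + x + P₀ + N₀) (code-size E c₀) ⟩
    c₀ + exprSize E + P₀ + N₀        ≡⟨ reorder c₀ (exprSize E) P₀ N₀ ⟩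
    c₀ + (P₀ + N₀) + exprSize E      ∎
    where
    open ≡-Reasoning
    P₀ = exprSize (plusPart (λ _ → one) W)
    N₀ = exprSize (minusPart (λ _ → one) W)
    ι-size : ∀ i → exprSize (ι i) ≡ exprSize one
    ι-size zero = refl
    ι-size (suc i) = refl
    sizes = split-size ι (λ _ → one) ι-size W
    reorder : ∀ a e p q → a + e + p + q ≡ a + (p + q) + e
    reorder = solve-∀

  c₃≤n : c₃ ≤ n
  c₃≤n = subst (_≤ n) (sym c₃≡) (*-cancelˡ-≤ 2 (begin
    2 * (a + exprSize E)     ≡⟨ *-distribˡ-+ 2 a (exprSize E) ⟩
    2 * a + 2 * exprSize E   ≤⟨ +-monoʳ-≤ (2 * a) (binary-fromℕ-size n) ⟩
    2 * a + (n + 11)         ≡⟨ reorder (2 * a) n ⟩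
    n + (11 + 2 * a)         ≤⟨ +-monoʳ-≤ n (<⇒≤ large) ⟩
    n + n                    ≡⟨ cong (_+_ n) (+-identityʳ n) ⟨
    2 * n                    ∎))
    where
    open ≤-Reasoning
    a = c₀ + splitSize W
    reorder : ∀ a n → a + (n + 11) ≡ n + (11 + a)
    reorder = solve-∀

  program-size : c₀ + size program ≡ n
  program-size = begin
    c₀ + (size (code E c₀) + (size (code P c₁) + (size (code N c₂) + size (padding (n ∸ c₃)))))
      ≡⟨ reassociate c₀ _ _ _ _ ⟩
    c₃ + size (padding (n ∸ c₃))   ≡⟨ cong (_+_ c₃) (size-padding (n ∸ c₃)) ⟩
    c₃ + (n ∸ c₃)                  ≡⟨ m+[n∸m]≡n c₃≤n ⟩
    n                              ∎
    where
    open ≡-Reasoning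
    reassociate : ∀ a b c d e → a + (b + (c + (d + e))) ≡ a + b + c + d + e
    reassociate = solve-∀

  constraints-within : All (VarsBelow n) constraints
  constraints-within =
    (0<n , 0<n , 0<n) ∷ (outP<n , 0<n , outN<n) ∷
    subst (λ b → All (VarsBelow b) (equations c₀ program)) program-size
          (equations-within program program-wellFormed)
    where
    0<n : 0 < n
    0<n = s≤s z≤n
    outP<n = <-≤-trans (out-bound P 0<c₁ P-inputs) (≤-trans (m≤m+n c₂ _) c₃≤n)
    outN<n = <-≤-trans (out-bound N 0<c₂ N-inputs) c₃≤n

  zero⇔balanced : ∀ {σ u} → Positive σ → σ 0 ≡ 1 → (∀ i → σ (suc (toℕ i)) ≡ suc (lookup u i)) →
                  σ ⊨* equations c₀ program →
                  Zero W (n ∷ []) u ⇔ σ (out P c₁) ≡ σ (out N c₂)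
  zero⇔balanced {σ} {u} pσ σ0 σu es =
    mk⇔ (λ z → trans σP (trans (Equivalence.to difference z) (sym σN)))
        (λ balanced → Equivalence.from difference (trans (sym σP) (trans balanced σN)))
    where
    esE = All.++⁻ˡ (equations c₀ (code E c₀)) es
    esPN = All.++⁻ʳ (equations c₀ (code E c₀)) es
    esP = All.++⁻ˡ (equations c₁ (code P c₁)) esPN
    esN = All.++⁻ˡ (equations c₂ (code N c₂)) (All.++⁻ʳ (equations c₁ (code P c₁)) esPN)
    σι : ∀ i → ⟦ ι i ⟧ σ ≡ suc (lookup (n ∷ u) i)
    σι zero = trans (out-value E c₀ σ0 pσ esE)
                    (trans (binary-value (ℕᵇ.fromℕ n)) (cong suc (toℕ-fromℕ n)))
    σι (suc i) = σu i
    σP = out-value P c₁ σ0 pσ esP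
    σN = out-value N c₂ σ0 pσ esN
    difference = difference-zero (split-eval ι (n ∷ u) σι W)

  inputs-positive : ∀ u → Positive (inputs u)
  inputs-positive u =
    valuation-positive (s≤s z≤n VecAll.∷ VecAll.map⁺ (VecAll.universal (λ _ → s≤s z≤n) u))

  inputs-at : ∀ u i → inputs u (suc (toℕ i)) ≡ suc (lookup u i)
  inputs-at u i = trans (cong (lookup (1 ∷ Vec.map suc u)) (clamp-toℕ (suc i))) (lookup-map i suc u)

  canonical-input : ∀ u i → canonical u (suc (toℕ i)) ≡ suc (lookup u i)
  canonical-input u i = trans (run-below program (s≤s (toℕ<n i))) (inputs-at u i)

  embed : Vec ℕ s → Vec ℕ n
  embed u = tabulate (canonical u ∘ toℕ)

  embed-agrees : ∀ u → AgreeBelow n (valuation (embed u)) (canonical u)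
  embed-agrees u = valuation-agrees {x = embed u} (lookup∘tabulate (canonical u ∘ toℕ))

  system : System n
  system = List.map toEqn constraints

  embed-sol : ∀ u → Zero W (n ∷ []) u → Sol system (embed u)
  embed-sol u z =
    tabulate-positive pτ ,
    ⊨*⇒holds {es = constraints} (⊨*-agree constraints-within (AgreeBelow-sym (embed-agrees u))
      (trans (cong₂ _*_ τ₀ τ₀) (sym τ₀) ∷
       trans (cong (τᵤ (out P c₁) *_) τ₀) (trans (*-identityʳ _) balanced) ∷
       τ-sound))
    where
    τᵤ = canonical u
    pτ = run-positive program (inputs-positive u)
    τ₀ : τᵤ 0 ≡ 1
    τ₀ = run-below program 0<c₀
    τ-sound = run-sound program program-wellFormed
    balanced = Equivalence.to (zero⇔balanced pτ τ₀ (canonical-input u) τ-sound) z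

  sol-embed : ∀ x → Sol system x → ∃ λ u → Zero W (n ∷ []) u × x ≡ embed u
  sol-embed x (px , holds) = u , Equivalence.from (zero⇔balanced pσ σ₀ σu eqs) balanced , x≡embed
    where
    σₓ = valuation x
    pσ = valuation-positive px
    all-es = holds⇒⊨* {es = constraints} holds
    eqs = All.tail (All.tail all-es)
    σ₀ : σₓ 0 ≡ 1
    σ₀ = n*n≡n⇒n≡1 (pσ 0) (All.head all-es)
    balanced = trans (sym (trans (cong (σₓ (out P c₁) *_) σ₀) (*-identityʳ _)))
                     (All.head (All.tail all-es))
    u = tabulate (λ i → pred (σₓ (suc (toℕ i))))
    σu : ∀ i → σₓ (suc (toℕ i)) ≡ suc (lookup u i)
    σu i = trans (sym (suc-pred _ {{>-nonZero (pσ _)}})) (cong suc (sym (lookup∘tabulate _ i)))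
    σ-inputs : AgreeBelow c₀ σₓ (inputs u)
    σ-inputs = AgreeBelow-sym (valuation-agrees {x = 1 ∷ Vec.map suc u} λ where
      zero → sym σ₀
      (suc i) → trans (lookup-map i suc u) (sym (σu i)))
    x≡embed = agree⇒≡tabulate (subst (λ b → AgreeBelow b σₓ (canonical u)) program-size
                (run-determined program program-wellFormed pσ σ-inputs eqs))

  embed-bounded : ∀ {b} u → VecAll.All (_≤ b) (embed u) → VecAll.All (_< b) u
  embed-bounded u ≤b = VecAll.lookup⁻ λ i →
    subst (_≤ _) (trans (embed-agrees u (suc (toℕ i)) (input<n i)) (canonical-input u i))
          (VecAll.lookup⁺ ≤b (clamp (suc (toℕ i))))
    where
    input<n : ∀ i → suc (toℕ i) < n
    input<n i = <-≤-trans (s≤s (toℕ<n i))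
                          (≤-trans (m≤m+n c₀ _) (≤-trans (m≤m+n c₁ _) (≤-trans (m≤m+n c₂ _) c₃≤n)))

simulation : ∀ {s} (W : Poly (suc s)) n → threshold W < n → Simulation W n
simulation W (suc n′) large = record { Construction W n′ large }

zero-below-θ : ∀ {s n b} {W : Poly (suc s)} → Simulation W n → ThetaProp n b →
               ∃ (Zero W (n ∷ [])) →
               (zs : List (Vec ℕ s)) → (∀ u → Zero W (n ∷ []) u → u ∈ zs) →
               ∃ λ u → Zero W (n ∷ []) u × VecAll.All (_< b) u
zero-below-θ {n = n} {b} {W} sim θ (u₀ , z₀) zs listed =
  bounded (θ system (embed u₀ , embed-sol u₀ z₀) (List.map embed zs , finitely-many))
  where
  open Simulation sim
  finitely-many : ∀ x → Sol system x → x ∈ List.map embed zs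
  finitely-many x sol with sol-embed x sol
  ... | u , z , refl = ∈-map⁺ embed (listed u z)
  bounded : (∃ λ x → Sol system x × VecAll.All (_≤ b) x) →
            ∃ λ u → Zero W (n ∷ []) u × VecAll.All (_< b) u
  bounded (x , sol , x≤b) with sol-embed x sol
  ... | u , z , refl = u , z , embed-bounded u x≤b

theorem5 : (f : ℕ → ℕ) → ((n : ℕ) → 1 ≤ n → 1 ≤ f n) →
    FiniteFoldDiophantine 2 (Graph f) →
    Σ ℕ λ m → (1 ≤ m) × ((n : ℕ) → m < n → (b : ℕ) → IsTheta n b → f n < b)
theorem5 f _ (r , W , represents , finitely-many) = threshold W , s≤s z≤n , f<θ
  where
  on-graph : ∀ {n y} xs → Zero W (n ∷ y ∷ []) xs → y ≡ f n
  on-graph xs z = proj₂ (proj₂ (represents _) (xs , z))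
  f<θ : (n : ℕ) → threshold W < n → (b : ℕ) → IsTheta n b → f n < b
  f<θ n large b (_ , θ , _) = head<b (zero-below-θ (simulation W n large) θ witness zs listed)
    where
    witness : ∃ (Zero W (n ∷ []))
    witness = let xs , z = proj₁ (represents (n ∷ f n ∷ [])) (≤-trans (s≤s z≤n) large , refl)
              in f n ∷ xs , z
    zs = List.map (f n ∷_) (proj₁ (finitely-many (n ∷ f n ∷ [])))
    listed : ∀ u → Zero W (n ∷ []) u → u ∈ zs
    listed (y ∷ xs) z with on-graph xs z
    ... | refl = ∈-map⁺ (f n ∷_) (proj₂ (finitely-many _) xs z)
    head<b : (∃ λ u → Zero W (n ∷ []) u × VecAll.All (_< b) u) → f n < b
    head<b (y ∷ xs , z , y<b VecAll.∷ _) = subst (_< b) (on-graph xs z) y<b
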